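{- Let $A$ be a graph of order $n$ and let $X=(m_{ij})$ be its stable graph obtained by the SaS process, with vertex partition $\mathcal C$ (vertices $u,v$ in the same cell iff $m_{uu}=m_{vv}$). Then: (1) $\mathcal C$ is a strongly equitable partition of $X$; (2) if $\{u\}$ is a singleton cell of $\mathcal C$, then for every cell $C_v=\{v_1,\dots,v_s\}$ of $\mathcal C$ one has $m_{uv_1}=\cdots=m_{uv_s}$; (3) for any two cells $C_u,C_v$ of $\mathcal C$, the number of neighbours in $A$ lying in $C_v$ of a vertex $w\in C_u$ does not depend on the choice of $w\in C_u$.
   Context: Labels are independent commuting indeterminates $x_0,x_1,\dots$; $\mathrm{Var}=\{x_1,x_2,\dots\}$. A graph of order $n$ is a symmetric $n\times n$ matrix $(a_{ij})$ over $\{x_0\}\cup\mathrm{Var}$ on vertex set $[n]$; $a_{ii}$ is the label of vertex $i$; for $i\neq j$, $j$ is a neighbour of $i$ iff $a_{ij}\ne x_0$. $\dim$ is the number of distinct entries. An equivalent variable substitution replaces the entries of a matrix by variables of $\mathrm{Var}$, equal entries by equal variables, distinct by distinct. SaS process: $A_1$ is $A$ with its diagonal entries replaced by an equivalent variable substitution using fresh variables not occurring off the diagonal; $A_{i+1}$ is obtained from $A_i^2$ (computed in the commutative polynomial ring) by an equivalent variable substitution; at the first $t$ with $\dim(A_t)=\dim(A_{t+1})$ the stable graph is $A_t$. A partition $\mathcal C=(C_1,\dots,C_p)$ of $[n]$ in which vertices with equal labels are in the same cell is equitable for a graph $(a_{ij})$ if for all cells $C_u=\{u_1,\dots,u_r\}$,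 $C_v=\{v_1,\dots,v_s\}$ and all $i,j$: the multisets $\{\!\{a_{u_iv_k}:k\in[s]\}\!\}$ and $\{\!\{a_{u_jv_k}:k\in[s]\}\!\}$ are equal, and $\{\!\{a_{u_kv_i}:k\in[r]\}\!\}=\{\!\{a_{u_kv_j}:k\in[r]\}\!\}$. It is strongly equitable if moreover for all cells $C_u,C_v,C_w$ with $C_v\ne C_w$ (with $C_w=\{w_1,\dots,w_t\}$), $\{\!\{a_{u_1v_k}:k\in[s]\}\!\}\cap\{\!\{a_{u_1w_k}:k\in[t]\}\!\}=\{\!\{a_{v_ku_1}:k\in[s]\}\!\}\cap\{\!\{a_{w_ku_1}:k\in[t]\}\!\}=\emptyset$. -}

module Defs where

open import Data.Nat using (ℕ; zero; suc; _+_; _≤_; _<_)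
open import Data.Nat as ℕ using ()
open import Data.Fin as Fin using (Fin)
open import Data.Bool using (Bool; true; false; if_then_else_; _∧_; _∨_; not)
open import Data.List using (List; length; map; concatMap; allFin; deduplicate)
open import Data.Product using (_×_; Σ)
open import Relation.Nullary using (¬_; does)
open import Relation.Binary.PropositionalEquality using (_≡_; _≢_)
open import Function.Bundles using (_⇔_)

-- Labels.  The label x_k is represented by the natural number k.
-- x_0 = 0 is the "non-edge" label; Var = {x_1, x_2, ...} = nonzero naturals.

Label : Set
Label = ℕ

x₀ : Label
x₀ = 0

InVar : Label → Set
InVar x = x ≢ x₀

Matrix : ℕ → Set
Matrix n = Fin n → Fin n → Label

IsGraph : ∀ {n} → Matrix n → Set
IsGraph {n} A = ∀ (i j : Fin n) → A i j ≡ A j i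

count : ∀ {n} → (Fin n → Bool) → ℕ
count {zero}  f = 0
count {suc n} f = (if f Fin.zero then 1 else 0) + count (λ k → f (Fin.suc k))

_==_ : ℕ → ℕ → Bool
a == b = does (a ℕ.≟ b)

_=F_ : ∀ {n} → Fin n → Fin n → Bool
a =F b = does (a Fin.≟ b)

entries : ∀ {n} → Matrix n → List Label
entries {n} A = concatMap (λ i → map (A i) (allFin n)) (allFin n)

dim : ∀ {n} → Matrix n → ℕ
dim A = length (deduplicate ℕ._≟_ (entries A))

-- The square A² in the commutative polynomial ring.
-- Since every entry of A is a single indeterminate, the (i,j) entry of A²
-- is the polynomial  Σ_k x_{A i k} · x_{A k j}.  A polynomial is determined
-- by its coefficients; the coefficient of the monomial x_p·x_q in this entry
-- is the number of k with {A i k , A k j} = {p , q} as multisets.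

sqCoeff : ∀ {n} → Matrix n → Fin n → Fin n → Label → Label → ℕ
sqCoeff A i j p q =
  count (λ k → ((A i k == p) ∧ (A k j == q)) ∨ ((A i k == q) ∧ (A k j == p)))

SqEntryEq : ∀ {n} → Matrix n → Fin n → Fin n → Fin n → Fin n → Set
SqEntryEq A i j k l = ∀ (p q : Label) → sqCoeff A i j p q ≡ sqCoeff A k l p q

IsEquivSubst : ∀ {n} → (Fin n → Fin n → Fin n → Fin n → Set) → Matrix n → Set
IsEquivSubst {n} Eq B =
  (∀ (i j : Fin n) → InVar (B i j)) ×
  (∀ (i j k l : Fin n) → Eq i j k l ⇔ (B i j ≡ B k l))

IsSaSInit : ∀ {n} → Matrix n → Matrix n → Set
IsSaSInit {n} A A₁ =
  (∀ (i j : Fin n) → i ≢ j → A₁ i j ≡ A i j) ×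
  (∀ (i : Fin n) → InVar (A₁ i i)) ×
  (∀ (i j : Fin n) → (A i i ≡ A j j) ⇔ (A₁ i i ≡ A₁ j j)) ×
  (∀ (i k l : Fin n) → k ≢ l → A₁ i i ≢ A k l)

IsSaSStep : ∀ {n} → Matrix n → Matrix n → Set
IsSaSStep Aᵢ Aᵢ₊₁ = IsEquivSubst (SqEntryEq Aᵢ) Aᵢ₊₁

-- A run of the SaS process on A: seq m is A_{m+1} (0-based indexing), and t
-- (0-based) is the first index with dim (seq t) = dim (seq (t+1)); the
-- stable graph is then seq t.
IsSaSRun : ∀ {n} → Matrix n → (ℕ → Matrix n) → ℕ → Set
IsSaSRun A seq t =
  IsSaSInit A (seq 0) ×
  (∀ m → m ≤ t → IsSaSStep (seq m) (seq (suc m))) ×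
  (∀ m → m < t → dim (seq m) ≢ dim (seq (suc m))) ×
  (dim (seq t) ≡ dim (seq (suc t)))

-- Partitions given by a cell-labelling function: u and v lie in the same
-- cell iff cell u ≡ cell v.  Every cell is named by any of its members.

SameCell : ∀ {n} → (Fin n → ℕ) → Fin n → Fin n → Bool
SameCell cell u v = cell u == cell v

rowMult : ∀ {n} → Matrix n → (Fin n → ℕ) → Fin n → Fin n → Label → ℕ
rowMult a cell u v x = count (λ k → SameCell cell k v ∧ (a u k == x))

colMult : ∀ {n} → Matrix n → (Fin n → ℕ) → Fin n → Fin n → Label → ℕ
colMult a cell u v x = count (λ k → SameCell cell k u ∧ (a k v == x))

IsEquitable : ∀ {n} → Matrix n → (Fin n → ℕ) → Set
IsEquitable {n} a cell =
  (∀ (i j : Fin n) → a i i ≡ a j j → cell i ≡ cell j) ×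
  (∀ (u u' v : Fin n) → cell u ≡ cell u' →
     ∀ x → rowMult a cell u v x ≡ rowMult a cell u' v x) ×
  (∀ (u v v' : Fin n) → cell v ≡ cell v' →
     ∀ x → colMult a cell u v x ≡ colMult a cell u v' x)

IsStronglyEquitable : ∀ {n} → Matrix n → (Fin n → ℕ) → Set
IsStronglyEquitable {n} a cell =
  IsEquitable a cell ×
  (∀ (u v w : Fin n) → cell v ≢ cell w → ∀ x →
     ¬ (0 < rowMult a cell u v x × 0 < rowMult a cell u w x)) ×
  (∀ (u v w : Fin n) → cell v ≢ cell w → ∀ x →
     ¬ (0 < colMult a cell v u x × 0 < colMult a cell w u x))

diagCell : ∀ {n} → Matrix n → Fin n → ℕ
diagCell X u = X u u

nbrsIn : ∀ {n} → Matrix n → (Fin n → ℕ) → Fin n → Fin n → ℕ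
nbrsIn A cell w v = count (λ k → SameCell cell k v ∧ not (k =F w) ∧ not (A w k == x₀))

-- Call a matrix separated if its diagonal labels never occur off the diagonal. A₁ is separated,
-- and for a separated symmetric Y the monomial x_{Y i i} x_{Y i j} of (Y²)_{ij} can only arise in
-- (Y²)_{kl} from a walk k k l or k l l; hence equal squares force equal entries, every A_{m+1} is
-- again separated, and the partition of positions by label only refines along the process. As dim
-- counts its classes, dim X = dim A_{t+1} means equal entries of X have equal squares. On the
-- diagonal this says that vertices with equal labels have the same multiset of row labels (the
-- coefficient of x_y² in (X²)_{uu}); off the diagonal it says that the endpoints of equally labelled
-- positions lie in the same cells, so each label of a row lies within a single cell. For (3), whether k is an A-neighbour of w is decided by the label X_{wk} alone, so the
-- number of neighbours in a cell is a function of the row multiset.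

module Submission where

open import Defs
open import Data.Nat as ℕ using (ℕ; zero; suc; _+_; _⊔_; _≤_; _<_; z≤n; s≤s)
open import Data.Nat.Properties
  using (+-suc; ≤-refl; ≤-reflexive; ≤-trans; n≤1+n; ≤∧≢⇒<; m≤m⊔n; m≤n⊔m; <-≤-trans; n≮n; ≤⇒≯; ≡ᵇ⇒≡; ≡⇒≡ᵇ)
open import Data.Fin as Fin using (Fin)
open import Data.Fin.Properties using (any?)
open import Data.Bool using (Bool; true; false; T; if_then_else_; _∧_; _∨_; not)
open import Data.Bool.Properties using (∧-assoc; ∧-zeroʳ; ∧-identityʳ; ∨-comm; ∧-comm; T-∧; T-∨)
open import Data.List using (List; []; _∷_; _++_; length; map; allFin; deduplicate)
open import Data.List.Properties using (length-map; length-++)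
open import Data.List.Relation.Unary.Any as Any using (here; there)
open import Data.List.Relation.Unary.All as All using (All)
open import Data.List.Relation.Unary.AllPairs using ([]; _∷_)
import Data.List.Relation.Unary.All.Properties as AllP
open import Data.List.Relation.Unary.Unique.Propositional using (Unique)
open import Data.List.Relation.Unary.Unique.DecPropositional.Properties using (deduplicate-!)
open import Data.List.Membership.Propositional using (_∈_)
open import Data.List.Membership.Propositional.Properties
open import Data.Product using (_×_; _,_; proj₁; proj₂; ∃; ∃₂)
open import Data.Sum using (_⊎_; inj₁; inj₂)
open import Data.Empty using (⊥-elim)
open import Relation.Nullary using (¬_; Dec; yes; no; does)
open import Relation.Nullary.Decidable using (dec-true; dec-false; _×-dec_; ¬?)
open import Relation.Binary.PropositionalEquality
open import Relation.Binary.Definitions using (DecidableEquality)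
open import Function.Bundles using (Equivalence)

open Equivalence using (to; from)

==⇒≡ : ∀ {a b} → T (a == b) → a ≡ b
==⇒≡ {a} {b} = ≡ᵇ⇒≡ a b

==-reflᵀ : ∀ a → T (a == a)
==-reflᵀ a = ≡⇒≡ᵇ a a refl

==-true : ∀ {a b} → a ≡ b → (a == b) ≡ true
==-true {a} {b} = dec-true (a ℕ.≟ b)

==-refl : ∀ a → (a == a) ≡ true
==-refl a = ==-true {a} refl

==-false : ∀ {a b} → a ≢ b → (a == b) ≡ false
==-false {a} {b} = dec-false (a ℕ.≟ b)

count-cong : ∀ {n} {f g : Fin n → Bool} → (∀ k → f k ≡ g k) → count f ≡ count g
count-cong {zero}  h = refl
count-cong {suc n} h =
  cong₂ (λ b c → (if b then 1 else 0) + c) (h Fin.zero) (count-cong (λ k → h (Fin.suc k)))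

count-none : ∀ {n} (f : Fin n → Bool) → (∀ k → f k ≡ false) → count f ≡ 0
count-none {zero}  f h = refl
count-none {suc n} f h rewrite h Fin.zero = count-none (λ k → f (Fin.suc k)) (λ k → h (Fin.suc k))

count-pos : ∀ {n} (f : Fin n → Bool) k → T (f k) → 0 < count f
count-pos {suc n} f Fin.zero    p with f Fin.zero
... | true = s≤s z≤n
count-pos {suc n} f (Fin.suc k) p with f Fin.zero
... | true  = s≤s z≤n
... | false = count-pos (λ k → f (Fin.suc k)) k p

count-witness : ∀ {n} (f : Fin n → Bool) → 0 < count f → ∃ λ k → T (f k)
count-witness {suc n} f p with f Fin.zero in eq
... | true  = Fin.zero , subst T (sym eq) _
... | false with k , q ← count-witness (λ k → f (Fin.suc k)) p = Fin.suc k , q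

count-split : ∀ {n} (f g : Fin n → Bool) →
  count f ≡ count (λ k → f k ∧ g k) + count (λ k → f k ∧ not (g k))
count-split {zero}  f g = refl
count-split {suc n} f g
  with f Fin.zero | g Fin.zero | count-split (λ k → f (Fin.suc k)) (λ k → g (Fin.suc k))
... | true  | true  | ih = cong suc ih
... | true  | false | ih = trans (cong suc ih) (sym (+-suc _ _))
... | false | _     | ih = ih

count-∧ˡ : ∀ {n} b (g : Fin n → Bool) → count (λ k → b ∧ g k) ≡ (if b then count g else 0)
count-∧ˡ true  g = refl
count-∧ˡ false g = count-none (λ k → false ∧ g k) (λ _ → refl)

bounded : ∀ {n} (f : Fin n → ℕ) → ∃ λ N → ∀ k → f k < N
bounded {zero}  f = 0 , λ ()
bounded {suc n} f with N , f<N ← bounded (λ k → f (Fin.suc k)) = suc (f Fin.zero) ⊔ N , below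
  where
  below : ∀ k → f k < suc (f Fin.zero) ⊔ N
  below Fin.zero    = <-≤-trans ≤-refl (m≤m⊔n _ N)
  below (Fin.suc k) = <-≤-trans (f<N k) (m≤n⊔m _ N)

module Fibres {n} (S : Fin n → Bool) where

  fibre : (Fin n → ℕ) → ℕ → ℕ
  fibre f x = count (λ k → S k ∧ (f k == x))

  countWhere : (ℕ → Bool) → (Fin n → ℕ) → ℕ
  countWhere Q f = count (λ k → S k ∧ Q (f k))

  countWhere-peel : ∀ Q N f → countWhere Q f ≡
    (if Q N then fibre f N else 0) + countWhere (λ x → Q x ∧ not (x == N)) f
  countWhere-peel Q N f = trans (count-split _ (λ k → f k == N))
    (cong₂ _+_ (trans (count-cong at-N) (count-∧ˡ (Q N) (λ k → S k ∧ (f k == N))))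
               (count-cong (λ k → ∧-assoc (S k) _ _)))
    where
    at-N : ∀ k → (S k ∧ Q (f k)) ∧ (f k == N) ≡ Q N ∧ (S k ∧ (f k == N))
    at-N k with f k ℕ.≟ N
    ... | yes refl rewrite ==-refl (f k) =
      trans (∧-identityʳ _) (trans (∧-comm (S k) _) (cong (Q (f k) ∧_) (sym (∧-identityʳ (S k)))))
    ... | no f≢N rewrite ==-false f≢N =
      trans (∧-zeroʳ _) (sym (trans (cong (Q N ∧_) (∧-zeroʳ (S k))) (∧-zeroʳ (Q N))))

  module _ {f g : Fin n → ℕ} (same-fibres : ∀ x → fibre f x ≡ fibre g x) where

    countWhere-cong-below : ∀ N Q → (∀ x → N ≤ x → Q x ≡ false) → countWhere Q f ≡ countWhere Q g
    countWhere-cong-below zero Q out = trans (none f) (sym (none g))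
      where
      none : ∀ h → countWhere Q h ≡ 0
      none h = count-none _ (λ k → trans (cong (S k ∧_) (out (h k) z≤n)) (∧-zeroʳ (S k)))
    countWhere-cong-below (suc N) Q out = begin
      countWhere Q f
        ≡⟨ countWhere-peel Q N f ⟩
      (if Q N then fibre f N else 0) + countWhere Q′ f
        ≡⟨ cong₂ _+_ (cong (λ c → if Q N then c else 0) (same-fibres N))
                     (countWhere-cong-below N Q′ out′) ⟩
      (if Q N then fibre g N else 0) + countWhere Q′ g
        ≡⟨ sym (countWhere-peel Q N g) ⟩
      countWhere Q g ∎
      where
      open ≡-Reasoning
      Q′ : ℕ → Bool
      Q′ x = Q x ∧ not (x == N)
      out′ : ∀ x → N ≤ x → Q′ x ≡ false
      out′ x N≤x with x ℕ.≟ N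
      ... | yes refl rewrite ==-refl x = ∧-zeroʳ (Q x)
      ... | no x≢N rewrite out x (≤∧≢⇒< N≤x (λ N≡x → x≢N (sym N≡x))) = refl

    countWhere-cong : ∀ Q → countWhere Q f ≡ countWhere Q g
    countWhere-cong Q = begin
      countWhere Q f   ≡⟨ count-cong (λ k → cong (S k ∧_) (sym (cut (f k) (ub-f k)))) ⟩
      countWhere Q<N f ≡⟨ countWhere-cong-below N Q<N out ⟩
      countWhere Q<N g ≡⟨ count-cong (λ k → cong (S k ∧_) (cut (g k) (ub-g k))) ⟩
      countWhere Q g   ∎
      where
      open ≡-Reasoning
      N = proj₁ (bounded (λ k → f k ⊔ g k))
      ub-f : ∀ k → f k < N
      ub-f k = <-≤-trans (s≤s (m≤m⊔n (f k) (g k))) (proj₂ (bounded (λ k → f k ⊔ g k)) k)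
      ub-g : ∀ k → g k < N
      ub-g k = <-≤-trans (s≤s (m≤n⊔m (f k) (g k))) (proj₂ (bounded (λ k → f k ⊔ g k)) k)
      Q<N : ℕ → Bool
      Q<N x = Q x ∧ does (x ℕ.<? N)
      cut : ∀ x → x < N → Q<N x ≡ Q x
      cut x x<N = trans (cong (Q x ∧_) (dec-true (x ℕ.<? N) x<N)) (∧-identityʳ (Q x))
      out : ∀ x → N ≤ x → Q<N x ≡ false
      out x N≤x = trans (cong (Q x ∧_) (dec-false (x ℕ.<? N) (≤⇒≯ N≤x))) (∧-zeroʳ (Q x))

module _ {a} {A : Set a} where

  unique-⊆⇒length-≤ : ∀ (xs ys : List A) → Unique xs → (∀ {z} → z ∈ xs → z ∈ ys) →
    length xs ≤ length ys
  unique-⊆⇒length-≤ []       ys _          _  = z≤n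
  unique-⊆⇒length-≤ (x ∷ xs) ys (x∉xs ∷ xs!) xs⊆ys
    with as , bs , refl ← ∈-∃++ (xs⊆ys (here refl)) =
    subst (suc (length xs) ≤_) (sym length-split) (s≤s (unique-⊆⇒length-≤ xs (as ++ bs) xs! xs⊆as++bs))
    where
    xs⊆as++bs : ∀ {z} → z ∈ xs → z ∈ as ++ bs
    xs⊆as++bs {z} z∈xs with ∈-++⁻ as (xs⊆ys (there z∈xs))
    ... | inj₁ z∈as         = ∈-++⁺ˡ z∈as
    ... | inj₂ (here z≡x)   = ⊥-elim (All.lookup x∉xs z∈xs (sym z≡x))
    ... | inj₂ (there z∈bs) = ∈-++⁺ʳ as z∈bs
    length-split : length (as ++ x ∷ bs) ≡ suc (length (as ++ bs))
    length-split = begin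
      length (as ++ x ∷ bs)           ≡⟨ length-++ as ⟩
      length as + suc (length bs)     ≡⟨ +-suc (length as) (length bs) ⟩
      suc (length as + length bs)     ≡⟨ cong suc (sym (length-++ as)) ⟩
      suc (length (as ++ bs))         ∎
      where open ≡-Reasoning

  unique-map⁺ : ∀ {b} {B : Set b} {xs : List A} (f : A → B) →
    (∀ {x y} → x ∈ xs → y ∈ xs → f x ≡ f y → x ≡ y) → Unique xs → Unique (map f xs)
  unique-map⁺ {xs = []}     f inj []           = []
  unique-map⁺ {xs = x ∷ xs} f inj (x∉xs ∷ xs!) =
    AllP.map⁺ (All.tabulate λ y∈xs fx≡fy → All.lookup x∉xs y∈xs (inj (here refl) (there y∈xs) fx≡fy))
    ∷ unique-map⁺ f (λ x∈ y∈ → inj (there x∈) (there y∈)) xs!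

module _ {a} {A : Set a} (_≟_ : DecidableEquality A) where

  open import Data.List.Membership.DecPropositional _≟_ using (_∈?_)

  unique-⊆-length-≤⇒⊇ : ∀ (xs ys : List A) → Unique xs → (∀ {z} → z ∈ xs → z ∈ ys) →
    length ys ≤ length xs → ∀ {y} → y ∈ ys → y ∈ xs
  unique-⊆-length-≤⇒⊇ xs ys xs! xs⊆ys ys≤xs {y} y∈ys with y ∈? xs
  ... | yes y∈xs = y∈xs
  ... | no  y∉xs = ⊥-elim (n≮n (length xs) (≤-trans longer ys≤xs))
    where
    y∷xs! : Unique (y ∷ xs)
    y∷xs! = All.tabulate (λ z∈xs y≡z → y∉xs (subst (_∈ xs) (sym y≡z) z∈xs)) ∷ xs!
    longer : suc (length xs) ≤ length ys
    longer = unique-⊆⇒length-≤ (y ∷ xs) ys y∷xs!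
      λ { (here refl) → y∈ys ; (there z∈xs) → xs⊆ys z∈xs }

∈-entries⁺ : ∀ {n} (M : Matrix n) i j → M i j ∈ entries M
∈-entries⁺ {n} M i j = ∈-concatMap⁺ (λ i → map (M i) (allFin n))
  (Any.map (λ { refl → ∈-map⁺ (M i) (∈-allFin j) }) (∈-allFin i))

∈-entries⁻ : ∀ {n} (M : Matrix n) {y} → y ∈ entries M → ∃₂ λ i j → y ≡ M i j
∈-entries⁻ {n} M y∈
  with i , y∈row ← Any.satisfied (∈-concatMap⁻ (λ i → map (M i) (allFin n)) {xs = allFin n} y∈)
  with j , _ , y≡Mij ← ∈-map⁻ (M i) y∈row = i , j , y≡Mij

labels : ∀ {n} → Matrix n → List Label
labels M = deduplicate ℕ._≟_ (entries M)

Finer : ∀ {n} → Matrix n → Matrix n → Set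
Finer {n} Y X = ∀ (i j k l : Fin n) → Y i j ≡ Y k l → X i j ≡ X k l

module _ {n} (X B : Matrix n) (B⊑X : Finer B X) where

  private
    representative : Label → Label
    representative y with any? (λ i → any? (λ j → X i j ℕ.≟ y))
    ... | yes (i , j , _) = B i j
    ... | no _            = 0

    representative-spec : ∀ {y} → y ∈ entries X → ∃₂ λ a b → X a b ≡ y × representative y ≡ B a b
    representative-spec {y} y∈ with any? (λ i → any? (λ j → X i j ℕ.≟ y))
    ... | yes (a , b , Xab≡y) = a , b , Xab≡y , refl
    ... | no  ∄ab = ⊥-elim (∄ab (let i , j , y≡Xij = ∈-entries⁻ X y∈ in i , j , sym y≡Xij))

    representatives : List Label
    representatives = map representative (labels X)

    representatives! : Unique representatives
    representatives! = unique-map⁺ representative injective (deduplicate-! ℕ._≟_ (entries X))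
      where
      injective : ∀ {y y′} → y ∈ labels X → y′ ∈ labels X →
        representative y ≡ representative y′ → y ≡ y′
      injective y∈ y′∈ r≡r′
        with a , b , Xab≡y , ry≡Bab ← representative-spec (∈-deduplicate⁻ ℕ._≟_ _ y∈)
           | a′ , b′ , Xa′b′≡y′ , ry′≡Ba′b′ ← representative-spec (∈-deduplicate⁻ ℕ._≟_ _ y′∈) =
        trans (sym Xab≡y)
          (trans (B⊑X a b a′ b′ (trans (sym ry≡Bab) (trans r≡r′ ry′≡Ba′b′))) Xa′b′≡y′)

    representatives⊆labels : ∀ {z} → z ∈ representatives → z ∈ labels B
    representatives⊆labels z∈ with y , y∈ , refl ← ∈-map⁻ representative z∈
      with a , b , _ , ry≡Bab ← representative-spec (∈-deduplicate⁻ ℕ._≟_ _ y∈) =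
      subst (_∈ labels B) (sym ry≡Bab) (∈-deduplicate⁺ ℕ._≟_ (∈-entries⁺ B a b))

  -- representative embeds labels X into labels B; equal dimension makes the embedding onto.
  dim-≡⇒finer : dim X ≡ dim B → Finer X B
  dim-≡⇒finer dimX≡dimB i j k l Xij≡Xkl =
    trans (sym (representative-section i j)) (trans (cong representative Xij≡Xkl) (representative-section k l))
    where
    representative-section : ∀ i j → representative (X i j) ≡ B i j
    representative-section i j
      with y , y∈ , Bij≡ry ← ∈-map⁻ representative
             (unique-⊆-length-≤⇒⊇ ℕ._≟_ representatives (labels B) representatives! representatives⊆labels
               (≤-reflexive (trans (sym dimX≡dimB) (sym (length-map representative (labels X)))))
               (∈-deduplicate⁺ ℕ._≟_ (∈-entries⁺ B i j)))
      with a , b , Xab≡y , ry≡Bab ← representative-spec (∈-deduplicate⁻ ℕ._≟_ _ y∈) =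
      trans (cong representative (trans (B⊑X i j a b (trans Bij≡ry ry≡Bab)) Xab≡y)) (sym Bij≡ry)

Separated : ∀ {n} → Matrix n → Set
Separated {n} Y = ∀ (i k l : Fin n) → k ≢ l → Y i i ≢ Y k l

module _ {n} {Y : Matrix n} (sep : Separated Y) where

  walk : Fin n → Fin n → Label → Label → Fin n → Bool
  walk k l p q m = ((Y k m == p) ∧ (Y m l == q)) ∨ ((Y k m == q) ∧ (Y m l == p))

  diagonal-label : ∀ {i k m} → Y k m ≡ Y i i → k ≡ m
  diagonal-label {i} {k} {m} Ykm≡Yii with k Fin.≟ m
  ... | yes k≡m = k≡m
  ... | no  k≢m = ⊥-elim (sep i k m k≢m (sym Ykm≡Yii))

  sqCoeff-diagonal : ∀ i j → 0 < sqCoeff Y i j (Y i i) (Y i j)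
  sqCoeff-diagonal i j = count-pos (walk i j (Y i i) (Y i j)) i
    (from (T-∨ {(Y i i == Y i i) ∧ (Y i j == Y i j)})
      (inj₁ (from (T-∧ {Y i i == Y i i}) (==-reflᵀ (Y i i) , ==-reflᵀ (Y i j)))))

  through-diagonalˡ : ∀ {i k m l q} → Y k m ≡ Y i i → Y m l ≡ q → Y k k ≡ Y i i × Y k l ≡ q
  through-diagonalˡ Ykm≡Yii Yml≡q with refl ← diagonal-label Ykm≡Yii = Ykm≡Yii , Yml≡q

  through-diagonalʳ : ∀ {i k m l q} → Y k m ≡ q → Y m l ≡ Y i i → Y l l ≡ Y i i × Y k l ≡ q
  through-diagonalʳ Ykm≡q Yml≡Yii with refl ← diagonal-label Yml≡Yii = Yml≡Yii , Ykm≡q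

  -- (Y²)_{ij} contains x_{Y i i} x_{Y i j}; in (Y²)_{kl} this monomial needs a walk k m l whose
  -- step labelled Y i i is, by separation, a loop.
  square-entry : ∀ {i j k l} → SqEntryEq Y i j k l →
    (Y k k ≡ Y i i × Y k l ≡ Y i j) ⊎ (Y l l ≡ Y i i × Y k l ≡ Y i j)
  square-entry {i} {j} {k} {l} sq
    with m , k→m→l ← count-witness (walk k l (Y i i) (Y i j))
                       (subst (0 <_) (sq (Y i i) (Y i j)) (sqCoeff-diagonal i j))
    with to T-∨ k→m→l
  ... | inj₁ first  = let Ykm , Yml = to T-∧ first  in inj₁ (through-diagonalˡ (==⇒≡ Ykm) (==⇒≡ Yml))
  ... | inj₂ second = let Ykm , Yml = to T-∧ second in inj₂ (through-diagonalʳ (==⇒≡ Ykm) (==⇒≡ Yml))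

  square-entry-≡ : ∀ {i j k l} → SqEntryEq Y i j k l → Y i j ≡ Y k l
  square-entry-≡ sq with square-entry sq
  ... | inj₁ (_ , Ykl≡Yij) = sym Ykl≡Yij
  ... | inj₂ (_ , Ykl≡Yij) = sym Ykl≡Yij

square-transpose : ∀ {n} {Y : Matrix n} → IsGraph Y → ∀ i j → SqEntryEq Y i j j i
square-transpose {Y = Y} sym-Y i j p q = count-cong swap
  where
  swap : ∀ m → ((Y i m == p) ∧ (Y m j == q)) ∨ ((Y i m == q) ∧ (Y m j == p)) ≡
               ((Y j m == p) ∧ (Y m i == q)) ∨ ((Y j m == q) ∧ (Y m i == p))
  swap m rewrite sym-Y j m | sym-Y m i =
    trans (∨-comm ((Y i m == p) ∧ (Y m j == q)) _)
          (cong₂ _∨_ (∧-comm (Y i m == q) (Y m j == p)) (∧-comm (Y i m == p) (Y m j == q)))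

step-finer : ∀ {n} {Y B : Matrix n} → Separated Y → IsSaSStep Y B → Finer B Y
step-finer {Y = Y} sep (_ , subst-B) i j k l Bij≡Bkl =
  square-entry-≡ {Y = Y} sep (from (subst-B i j k l) Bij≡Bkl)

step-invariant : ∀ {n} {Y B : Matrix n} → IsGraph Y × Separated Y → IsSaSStep Y B → IsGraph B × Separated B
step-invariant (sym-Y , sep) step@(_ , subst-B) =
  (λ i j → to (subst-B i j j i) (square-transpose sym-Y i j)) ,
  (λ i k l k≢l Bii≡Bkl → sep i k l k≢l (step-finer sep step i i k l Bii≡Bkl))

init-invariant : ∀ {n} {A A₁ : Matrix n} → IsGraph A → IsSaSInit A A₁ → IsGraph A₁ × Separated A₁
init-invariant {A = A} {A₁} sym-A (off , _ , _ , fresh) = sym-A₁ , sep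
  where
  sym-A₁ : IsGraph A₁
  sym-A₁ i j with i Fin.≟ j
  ... | yes refl = refl
  ... | no  i≢j  = trans (off i j i≢j) (trans (sym-A i j) (sym (off j i (λ j≡i → i≢j (sym j≡i)))))
  sep : Separated A₁
  sep i k l k≢l A₁ii≡A₁kl = fresh i k l k≢l (trans A₁ii≡A₁kl (off k l k≢l))

module _ {n} {A : Matrix n} {seq : ℕ → Matrix n} {t : ℕ} (sym-A : IsGraph A) (run : IsSaSRun A seq t) where

  private
    steps : ∀ m → m ≤ t → IsSaSStep (seq m) (seq (suc m))
    steps = proj₁ (proj₂ run)

  run-invariant : ∀ m → m ≤ t → IsGraph (seq m) × Separated (seq m)
  run-invariant zero    _   = init-invariant sym-A (proj₁ run)
  run-invariant (suc m) m<t = step-invariant (run-invariant m m≤t) (steps m m≤t)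
    where m≤t = ≤-trans (n≤1+n m) m<t

  run-finer : ∀ m → m ≤ t → Finer (seq m) (seq 0)
  run-finer zero    _   i j k l e = e
  run-finer (suc m) m<t i j k l e =
    run-finer m m≤t i j k l (step-finer (proj₂ (run-invariant m m≤t)) (steps m m≤t) i j k l e)
    where m≤t = ≤-trans (n≤1+n m) m<t

  run-stable : ∀ i j k l → seq t i j ≡ seq t k l → SqEntryEq (seq t) i j k l
  run-stable i j k l e = from (proj₂ (steps t ≤-refl) i j k l)
    (dim-≡⇒finer (seq t) (seq (suc t)) (step-finer (proj₂ (run-invariant t ≤-refl)) (steps t ≤-refl))
                 (proj₂ (proj₂ (proj₂ run))) i j k l e)

module StableGraph {n} {X : Matrix n} (sym-X : IsGraph X) (sep : Separated X)
  (stable : ∀ i j k l → X i j ≡ X k l → SqEntryEq X i j k l) where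

  private
    cell : Fin n → ℕ
    cell = diagCell X

  equal-entries⇒endpoint : ∀ {i j k l} → X i j ≡ X k l → X i i ≡ X k k ⊎ X i i ≡ X l l
  equal-entries⇒endpoint e with square-entry sep (stable _ _ _ _ e)
  ... | inj₁ (Xkk≡Xii , _) = inj₁ (sym Xkk≡Xii)
  ... | inj₂ (Xll≡Xii , _) = inj₂ (sym Xll≡Xii)

  equal-entries⇒target-cell : ∀ {a k a′ k′} → X a k ≡ X a′ k′ → X a a ≡ X a′ a′ → X k k ≡ X k′ k′
  equal-entries⇒target-cell {a} {k} {a′} {k′} e Xaa≡Xa′a′
    with equal-entries⇒endpoint (trans (sym-X k a) (trans e (sym-X a′ k′)))
       | equal-entries⇒endpoint (trans (sym-X k′ a′) (trans (sym e) (sym-X a k)))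
  ... | inj₁ Xkk≡Xk′k′ | _              = Xkk≡Xk′k′
  ... | inj₂ _         | inj₁ Xk′k′≡Xkk = sym Xk′k′≡Xkk
  ... | inj₂ Xkk≡Xa′a′ | inj₂ Xk′k′≡Xaa = trans Xkk≡Xa′a′ (trans (sym Xaa≡Xa′a′) (sym Xk′k′≡Xaa))

  rowCount : Fin n → Label → ℕ
  rowCount u x = count (λ k → X u k == x)

  -- (X²)_{uu} has coefficient rowCount u x at x², so equal diagonal labels give equal rows.
  rowCount-cell : ∀ {u u′} → X u u ≡ X u′ u′ → ∀ x → rowCount u x ≡ rowCount u′ x
  rowCount-cell {u} {u′} Xuu≡Xu′u′ x =
    trans (sym (diagonal-coeff u)) (trans (stable u u u′ u′ Xuu≡Xu′u′ x x) (diagonal-coeff u′))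
    where
    idem : ∀ b → (b ∧ b) ∨ (b ∧ b) ≡ b
    idem true  = refl
    idem false = refl
    diagonal-coeff : ∀ w → sqCoeff X w w x x ≡ rowCount w x
    diagonal-coeff w = count-cong λ m →
      trans (cong (λ y → ((X w m == x) ∧ (y == x)) ∨ ((X w m == x) ∧ (y == x))) (sym-X m w)) (idem _)

  rowMult-all : ∀ {u u′ v k₀ x} → X u u ≡ X u′ u′ → X k₀ k₀ ≡ X v v → X u k₀ ≡ x →
    rowMult X cell u′ v x ≡ rowCount u′ x
  rowMult-all {u} {u′} {v} {k₀} {x} Xuu≡Xu′u′ k₀∈Cv Xuk₀≡x = count-cong in-cell
    where
    in-cell : ∀ k → (X k k == X v v) ∧ (X u′ k == x) ≡ (X u′ k == x)
    in-cell k with X u′ k ℕ.≟ x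
    ... | no  Xu′k≢x rewrite ==-false Xu′k≢x = ∧-zeroʳ _
    ... | yes Xu′k≡x
      rewrite ==-true Xu′k≡x
            | ==-true {X k k} {X v v}
                (trans (equal-entries⇒target-cell (trans Xu′k≡x (sym Xuk₀≡x)) (sym Xuu≡Xu′u′)) k₀∈Cv) = refl

  rowMult-witness : ∀ u v x → rowMult X cell u v x ≡ 0 ⊎ ∃ λ k₀ → X k₀ k₀ ≡ X v v × X u k₀ ≡ x
  rowMult-witness u v x with rowMult X cell u v x in eq
  ... | zero  = inj₁ refl
  ... | suc _
    with k₀ , hit ← count-witness (λ k → SameCell cell k v ∧ (X u k == x)) (subst (0 <_) (sym eq) (s≤s z≤n)) =
    let k₀∈Cv , Xuk₀≡x = to T-∧ hit in inj₂ (k₀ , ==⇒≡ k₀∈Cv , ==⇒≡ Xuk₀≡x)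

  rowMult-cell : ∀ {u u′} v → X u u ≡ X u′ u′ → ∀ x → rowMult X cell u v x ≡ rowMult X cell u′ v x
  rowMult-cell {u} {u′} v Xuu≡Xu′u′ x with rowMult-witness u v x | rowMult-witness u′ v x
  ... | inj₂ (k₀ , k₀∈Cv , Xuk₀≡x) | _ =
    trans (rowMult-all refl k₀∈Cv Xuk₀≡x)
      (trans (rowCount-cell Xuu≡Xu′u′ x) (sym (rowMult-all Xuu≡Xu′u′ k₀∈Cv Xuk₀≡x)))
  ... | inj₁ _ | inj₂ (k₀ , k₀∈Cv , Xu′k₀≡x) =
    trans (rowMult-all (sym Xuu≡Xu′u′) k₀∈Cv Xu′k₀≡x)
      (trans (rowCount-cell Xuu≡Xu′u′ x) (sym (rowMult-all refl k₀∈Cv Xu′k₀≡x)))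
  ... | inj₁ none | inj₁ none′ = trans none (sym none′)

  colMult≡rowMult : ∀ u v x → colMult X cell u v x ≡ rowMult X cell v u x
  colMult≡rowMult u v x = count-cong (λ k → cong (λ y → SameCell cell k u ∧ (y == x)) (sym-X k v))

  colMult-cell : ∀ u {v v′} → X v v ≡ X v′ v′ → ∀ x → colMult X cell u v x ≡ colMult X cell u v′ x
  colMult-cell u {v} {v′} Xvv≡Xv′v′ x =
    trans (colMult≡rowMult u v x) (trans (rowMult-cell u Xvv≡Xv′v′ x) (sym (colMult≡rowMult u v′ x)))

  rowMult-disjoint : ∀ u v w → X v v ≢ X w w → ∀ x →
    ¬ (0 < rowMult X cell u v x × 0 < rowMult X cell u w x)
  rowMult-disjoint u v w Xvv≢Xww x (in-Cv , in-Cw)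
    with k₁ , hit₁ ← count-witness (λ k → SameCell cell k v ∧ (X u k == x)) in-Cv
       | k₂ , hit₂ ← count-witness (λ k → SameCell cell k w ∧ (X u k == x)) in-Cw =
    let k₁∈Cv , Xuk₁≡x = to T-∧ hit₁
        k₂∈Cw , Xuk₂≡x = to T-∧ hit₂
    in Xvv≢Xww (trans (sym (==⇒≡ k₁∈Cv))
         (trans (equal-entries⇒target-cell (trans (==⇒≡ Xuk₁≡x) (sym (==⇒≡ Xuk₂≡x))) refl) (==⇒≡ k₂∈Cw)))

  strongly-equitable : IsStronglyEquitable X cell
  strongly-equitable =
    ((λ _ _ Xii≡Xjj → Xii≡Xjj) , (λ u u′ v → rowMult-cell v) , (λ u v v′ → colMult-cell u)) ,
    rowMult-disjoint ,
    λ u v w Xvv≢Xww x (in-Cv , in-Cw) → rowMult-disjoint u v w Xvv≢Xww x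
      (subst (0 <_) (colMult≡rowMult v u x) in-Cv , subst (0 <_) (colMult≡rowMult w u x) in-Cw)

  singleton-row-constant : ∀ u → (∀ k → X k k ≡ X u u → k ≡ u) →
    ∀ v k k′ → X k k ≡ X v v → X k′ k′ ≡ X v v → X u k ≡ X u k′
  singleton-row-constant u singleton v k k′ k∈Cv k′∈Cv
    with m , hit ← count-witness (λ m → SameCell cell m u ∧ (X m k′ == X u k))
           (subst (0 <_) (colMult-cell u (trans k∈Cv (sym k′∈Cv)) (X u k))
             (count-pos (λ m → SameCell cell m u ∧ (X m k == X u k)) u
               (from (T-∧ {X u u == X u u}) (==-reflᵀ (X u u) , ==-reflᵀ (X u k)))))
    with m∈Cu , Xmk′≡Xuk ← to T-∧ hit
    with refl ← singleton m (==⇒≡ m∈Cu) = sym (==⇒≡ Xmk′≡Xuk)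

module Neighbours {n} {X A A₁ : Matrix n} (sym-X : IsGraph X) (sep : Separated X)
  (stable : ∀ i j k l → X i j ≡ X k l → SqEntryEq X i j k l)
  (off-diagonal : ∀ i j → i ≢ j → A₁ i j ≡ A i j) (X⊑A₁ : Finer X A₁) where

  open StableGraph sym-X sep stable using (rowMult-cell)

  IsEdgeLabel : Label → Fin n → Fin n → Set
  IsEdgeLabel x i j = X i j ≡ x × A₁ i j ≢ x₀

  edgeLabel? : ∀ x → Dec (∃₂ (IsEdgeLabel x))
  edgeLabel? x = any? λ i → any? λ j → (X i j ℕ.≟ x) ×-dec ¬? (A₁ i j ℕ.≟ x₀)

  edgeLabel : Label → Bool
  edgeLabel x = does (edgeLabel? x)

  edgeLabel-spec : ∀ w k → edgeLabel (X w k) ≡ not (A₁ w k == x₀)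
  edgeLabel-spec w k with A₁ w k ℕ.≟ x₀
  ... | yes A₁wk≡x₀ rewrite ==-true A₁wk≡x₀ = dec-false (edgeLabel? (X w k))
    λ (i , j , Xij≡Xwk , A₁ij≢x₀) → A₁ij≢x₀ (trans (X⊑A₁ i j w k Xij≡Xwk) A₁wk≡x₀)
  ... | no  A₁wk≢x₀ rewrite ==-false A₁wk≢x₀ = dec-true (edgeLabel? (X w k)) (w , k , refl , A₁wk≢x₀)

  neighbourLabel : Label → Label → Bool
  neighbourLabel c x = not (x == c) ∧ edgeLabel x

  -- Separation recognises the diagonal by its label; off it, A agrees with A₁, which X refines.
  neighbour-by-label : ∀ w k → not (k =F w) ∧ not (A w k == x₀) ≡ neighbourLabel (X w w) (X w k)
  neighbour-by-label w k with k Fin.≟ w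
  ... | yes refl rewrite ==-refl (X k k) = refl
  ... | no  k≢w rewrite ==-false (λ Xwk≡Xww → sep w w k (λ w≡k → k≢w (sym w≡k)) (sym Xwk≡Xww))
                      | sym (off-diagonal w k (λ w≡k → k≢w (sym w≡k))) = sym (edgeLabel-spec w k)

  neighbours-cell : ∀ {w w′} v → X w w ≡ X w′ w′ →
    nbrsIn A (diagCell X) w v ≡ nbrsIn A (diagCell X) w′ v
  neighbours-cell {w} {w′} v Xww≡Xw′w′ = begin
    nbrsIn A (diagCell X) w v
      ≡⟨ count-cong (λ k → cong (S k ∧_) (neighbour-by-label w k)) ⟩
    countWhere (neighbourLabel (X w w)) (X w)
      ≡⟨ countWhere-cong (rowMult-cell v Xww≡Xw′w′) (neighbourLabel (X w w)) ⟩
    countWhere (neighbourLabel (X w w)) (X w′)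
      ≡⟨ cong (λ c → countWhere (neighbourLabel c) (X w′)) Xww≡Xw′w′ ⟩
    countWhere (neighbourLabel (X w′ w′)) (X w′)
      ≡⟨ sym (count-cong (λ k → cong (S k ∧_) (neighbour-by-label w′ k))) ⟩
    nbrsIn A (diagCell X) w′ v ∎
    where
    open ≡-Reasoning
    S : Fin n → Bool
    S k = SameCell (diagCell X) k v
    open Fibres S using (countWhere; countWhere-cong)

theorem5 : ∀ (n : ℕ) (A : Matrix n) → IsGraph A →
    ∀ (seq : ℕ → Matrix n) (t : ℕ) → IsSaSRun A seq t →
    IsStronglyEquitable (seq t) (diagCell (seq t)) ×
    (∀ (u : Fin n) → (∀ (k : Fin n) → seq t k k ≡ seq t u u → k ≡ u) →
    ∀ (v k k′ : Fin n) → seq t k k ≡ seq t v v → seq t k′ k′ ≡ seq t v v →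
    seq t u k ≡ seq t u k′) ×
    (∀ (w w′ v : Fin n) → seq t w w ≡ seq t w′ w′ →
    nbrsIn A (diagCell (seq t)) w v ≡ nbrsIn A (diagCell (seq t)) w′ v)
theorem5 n A sym-A seq t run =
  strongly-equitable ,
  singleton-row-constant ,
  λ w w′ v → neighbours-cell v
  where
  X-invariant : IsGraph (seq t) × Separated (seq t)
  X-invariant = run-invariant sym-A run t ≤-refl
  open StableGraph (proj₁ X-invariant) (proj₂ X-invariant) (run-stable sym-A run)
  open Neighbours (proj₁ X-invariant) (proj₂ X-invariant) (run-stable sym-A run)
    (proj₁ (proj₁ run)) (run-finer sym-A run t ≤-refl)
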